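{- Let $k$ be a positive integer. If there exists an even integer $u\ge2$ such that $L_{u+2}(k)=1\,0\,1^u$, then $f(k)<k$.
   Context: $s_2(n)$ is the binary sum of digits of $n\ge0$, $t_n=s_2(n)\bmod 2$, and $f(k)=\min\{n\ge0: t_{kn}=1\}$ for $k\ge1$. If $k=\sum_{i=0}^{\ell-1}\varepsilon_i 2^i$ with $\varepsilon_i\in\{0,1\}$, $\varepsilon_{\ell-1}=1$, then $\ell=\ell(k)$ is the binary length, and for $1\le j\le \ell(k)$, $L_j(k)$ is the word $\varepsilon_{j-1}\cdots\varepsilon_0$ of the $j$ least significant binary digits (use of $L_j(k)$ presupposes $\ell(k)\ge j$). For $a\in\{0,1\}$, $a^n$ denotes the word consisting of $n$ copies of $a$; juxtaposition denotes concatenation. -}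

module Defs where

open import Data.Nat using (ℕ; zero; suc; _+_; _*_; _<_; _≤_; _≥_)
open import Data.Nat.DivMod using (_/_; _%_)
open import Data.List using (List; []; _∷_; reverse; take; length; replicate; _++_)
open import Data.Nat.ListAction using (sum)
open import Data.Product using (_×_)
open import Relation.Binary.PropositionalEquality using (_≡_)

-- binary digits of n, least significant first (fuel n suffices since n/2 < n)
bitsAux : ℕ → ℕ → List ℕ
bitsAux zero    n       = []
bitsAux (suc f) zero    = []
bitsAux (suc f) (suc m) = (suc m % 2) ∷ bitsAux f (suc m / 2)

bits : ℕ → List ℕ
bits n = bitsAux n n

ℓ : ℕ → ℕ
ℓ k = length (bits k)

s₂ : ℕ → ℕ
s₂ n = sum (bits n)

t : ℕ → ℕ
t n = s₂ n % 2

-- f(k) = m : m is the least n ≥ 0 with t_{kn} = 1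
IsF : ℕ → ℕ → Set
IsF k m = (t (k * m) ≡ 1) × (∀ n → n < m → t (k * n) ≡ 0)

L : ℕ → ℕ → List ℕ
L j k = reverse (take j (bits k))

module Submission where

-- Write k = 2^(w+4) C + 2^(w+3) + 2^(w+2) − 1 with w even, i.e. k is C followed by the
-- binary digits 1 0 1^(w+2).  Depending on the shape of the leading run of ones of C we
-- exhibit n < k, namely 2^(w+2) + 1, 2^(w+4+d) − 1 or 2^(w+4+g) + 1, for which k n splits
-- into binary blocks T (T A + R) + B with R, B < T a power of two.  Then s₂(k n) is the
-- sum of the digit sums of A, R and B, which are all computed exactly, and it is odd; so
-- t (k n) = 1 and f(k) ≤ n < k.

open import Defs
open import Data.Nat using (ℕ; zero; suc; _+_; _*_; _^_; _<_; _≤_; z≤n; s≤s; _≤?_; _≟_)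
open import Data.Nat.Properties
open import Data.Nat.DivMod
open import Data.Nat.Induction using (<-rec)
open import Data.Nat.ListAction using (sum)
open import Data.Nat.Tactic.RingSolver using (solve-∀)
open import Data.List using (List; []; _∷_; _++_; _∷ʳ_; length; take; reverse; replicate)
open import Data.List.Properties using (∷-injective; reverse-++; reverse-involutive; unfold-reverse)
open import Data.Product using (_×_; _,_; ∃-syntax)
open import Relation.Binary.PropositionalEquality
open import Relation.Nullary using (yes; no; ¬_; contradiction)
open import Relation.Unary using (Decidable)

[1+m]/2≤m : ∀ m → suc m / 2 ≤ m
[1+m]/2≤m m = m<1+n⇒m≤n (m/n<m (suc m) 2 (s≤s (s≤s z≤n)))

bitsAux-fuel : ∀ f g n → n ≤ f → n ≤ g → bitsAux f n ≡ bitsAux g n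
bitsAux-fuel zero    zero    zero    _         _         = refl
bitsAux-fuel zero    (suc g) zero    _         _         = refl
bitsAux-fuel (suc f) zero    zero    _         _         = refl
bitsAux-fuel (suc f) (suc g) zero    _         _         = refl
bitsAux-fuel (suc f) (suc g) (suc m) (s≤s m≤f) (s≤s m≤g) =
  cong (suc m % 2 ∷_) (bitsAux-fuel f g (suc m / 2) (≤-trans ([1+m]/2≤m m) m≤f) (≤-trans ([1+m]/2≤m m) m≤g))

bits-suc : ∀ m → bits (suc m) ≡ suc m % 2 ∷ bits (suc m / 2)
bits-suc m = cong (suc m % 2 ∷_) (bitsAux-fuel m (suc m / 2) (suc m / 2) ([1+m]/2≤m m) ≤-refl)

s₂[n]≡n%2+s₂[n/2] : ∀ n → 0 < n → s₂ n ≡ n % 2 + s₂ (n / 2)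
s₂[n]≡n%2+s₂[n/2] (suc m) _ = cong sum (bits-suc m)

[2*n]%2≡0 : ∀ n → 2 * n % 2 ≡ 0
[2*n]%2≡0 n = trans (cong (_% 2) (*-comm 2 n)) (m*n%n≡0 n 2)

[2*n]/2≡n : ∀ n → 2 * n / 2 ≡ n
[2*n]/2≡n n = trans (cong (_/ 2) (*-comm 2 n)) (m*n/n≡m n 2)

[1+2*n]%2≡1 : ∀ n → (1 + 2 * n) % 2 ≡ 1
[1+2*n]%2≡1 n = trans (cong (λ m → (1 + m) % 2) (*-comm 2 n)) ([m+kn]%n≡m%n 1 n 2)

[1+2*n]/2≡n : ∀ n → (1 + 2 * n) / 2 ≡ n
[1+2*n]/2≡n n = trans (+-distrib-/ 1 (2 * n) (subst (λ r → 1 + r < 2) (sym ([2*n]%2≡0 n)) ≤-refl))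
                      ([2*n]/2≡n n)

s₂-double : ∀ n → s₂ (2 * n) ≡ s₂ n
s₂-double zero    = refl
s₂-double (suc n) = trans (s₂[n]≡n%2+s₂[n/2] (2 * suc n) (s≤s z≤n))
  (cong₂ _+_ ([2*n]%2≡0 (suc n)) (cong s₂ ([2*n]/2≡n (suc n))))

s₂-double+1 : ∀ n → s₂ (1 + 2 * n) ≡ 1 + s₂ n
s₂-double+1 n = trans (s₂[n]≡n%2+s₂[n/2] (1 + 2 * n) (s≤s z≤n)) (cong₂ _+_ ([1+2*n]%2≡1 n) (cong s₂ ([1+2*n]/2≡n n)))

data EvenOdd : ℕ → Set where
  even : ∀ q → EvenOdd (2 * q)
  odd  : ∀ q → EvenOdd (1 + 2 * q)

even-or-odd : ∀ n → EvenOdd n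
even-or-odd zero = even 0
even-or-odd (suc n) with even-or-odd n
... | even q = odd q
... | odd q  = subst EvenOdd (cong suc (+-suc q (q + 0))) (even (suc q))

s₂-concat : ∀ a x {y} → y < 2 ^ a → s₂ (2 ^ a * x + y) ≡ s₂ x + s₂ y
s₂-concat zero x (s≤s z≤n) = trans (cong s₂ (trans (+-identityʳ _) (*-identityˡ x))) (sym (+-identityʳ _))
s₂-concat (suc a) x {y} = append (even-or-odd y)
  where
  open ≡-Reasoning
  append-even : ∀ q → 2 * q < 2 ^ suc a → s₂ (2 * 2 ^ a * x + 2 * q) ≡ s₂ x + s₂ (2 * q)
  append-even q 2q<2^1+a = begin
    s₂ (2 * 2 ^ a * x + 2 * q)   ≡⟨ cong s₂ (lift (2 ^ a) x q) ⟩
    s₂ (2 * (2 ^ a * x + q))     ≡⟨ s₂-double (2 ^ a * x + q) ⟩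
    s₂ (2 ^ a * x + q)           ≡⟨ s₂-concat a x (*-cancelˡ-< 2 q (2 ^ a) 2q<2^1+a) ⟩
    s₂ x + s₂ q                  ≡⟨ cong (s₂ x +_) (s₂-double q) ⟨
    s₂ x + s₂ (2 * q)            ∎
    where
    lift : ∀ P x q → 2 * P * x + 2 * q ≡ 2 * (P * x + q)
    lift = solve-∀

  append-odd : ∀ q → 1 + 2 * q < 2 ^ suc a → s₂ (2 * 2 ^ a * x + (1 + 2 * q)) ≡ s₂ x + s₂ (1 + 2 * q)
  append-odd q 1+2q<2^1+a = begin
    s₂ (2 * 2 ^ a * x + (1 + 2 * q)) ≡⟨ cong s₂ (lift (2 ^ a) x q) ⟩
    s₂ (1 + 2 * (2 ^ a * x + q))     ≡⟨ s₂-double+1 (2 ^ a * x + q) ⟩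
    1 + s₂ (2 ^ a * x + q)           ≡⟨ cong suc (s₂-concat a x (*-cancelˡ-< 2 q (2 ^ a) (<-trans (n<1+n _) 1+2q<2^1+a))) ⟩
    1 + (s₂ x + s₂ q)                ≡⟨ +-suc (s₂ x) (s₂ q) ⟨
    s₂ x + (1 + s₂ q)                ≡⟨ cong (s₂ x +_) (s₂-double+1 q) ⟨
    s₂ x + s₂ (1 + 2 * q)            ∎
    where
    lift : ∀ P x q → 2 * P * x + (1 + 2 * q) ≡ 1 + 2 * (P * x + q)
    lift = solve-∀

  append : ∀ {y} → EvenOdd y → y < 2 ^ suc a → s₂ (2 ^ suc a * x + y) ≡ s₂ x + s₂ y
  append (even q) = append-even q
  append (odd q)  = append-odd q

ones : ℕ → ℕ
ones zero    = 0
ones (suc a) = 1 + 2 * ones a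

2^≡1+ones : ∀ a → 2 ^ a ≡ suc (ones a)
2^≡1+ones zero    = refl
2^≡1+ones (suc a) = trans (cong (2 *_) (2^≡1+ones a)) (double-suc (ones a))
  where
  double-suc : ∀ o → 2 * suc o ≡ suc (1 + 2 * o)
  double-suc = solve-∀

ones<2^ : ∀ a → ones a < 2 ^ a
ones<2^ a = ≤-reflexive (sym (2^≡1+ones a))

ones-+ : ∀ m n → ones (m + n) ≡ 2 ^ n * ones m + ones n
ones-+ m zero    = trans (cong ones (+-identityʳ m)) (sym (trans (+-identityʳ _) (*-identityˡ _)))
ones-+ m (suc n) = trans (cong ones (+-suc m n))
  (trans (cong (λ v → 1 + 2 * v) (ones-+ m n)) (distrib (2 ^ n) (ones m) (ones n)))
  where
  distrib : ∀ P a b → 1 + 2 * (P * a + b) ≡ 2 * P * a + (1 + 2 * b)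
  distrib = solve-∀

ones-mono-≤ : ∀ {m n} → m ≤ n → ones m ≤ ones n
ones-mono-≤ {m} {n} m≤n = m<1+n⇒m≤n (<-≤-trans (ones<2^ m) (≤-trans (^-monoʳ-≤ 2 m≤n) (≤-reflexive (2^≡1+ones n))))

complement : ∀ a {x} → x < 2 ^ a → ∃[ y ] x + y ≡ ones a
complement a x<2^a = m≤n⇒∃[o]m+o≡n (m<1+n⇒m≤n (subst (_ <_) (2^≡1+ones a) x<2^a))

s₂-complement : ∀ a {y z} → y + z ≡ ones a → s₂ y + s₂ z ≡ a
s₂-complement zero {zero} {zero} _ = refl
s₂-complement (suc a) {y} {z} = digits (even-or-odd y) (even-or-odd z)
  where
  digits : ∀ {y z} → EvenOdd y → EvenOdd z → y + z ≡ ones (suc a) → s₂ y + s₂ z ≡ suc a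
  digits (even q) (even r) eq = contradiction (trans (*-distribˡ-+ 2 q r) eq) (even≢odd (q + r) (ones a))
  digits (odd q)  (odd r)  eq = contradiction (trans (sym (suc-injective eq)) (regroup q r)) (even≢odd (ones a) (q + r))
    where
    regroup : ∀ q r → 2 * q + suc (2 * r) ≡ suc (2 * (q + r))
    regroup = solve-∀
  digits (even q) (odd r)  eq = begin
    s₂ (2 * q) + s₂ (1 + 2 * r) ≡⟨ cong₂ _+_ (s₂-double q) (s₂-double+1 r) ⟩
    s₂ q + (1 + s₂ r)           ≡⟨ +-suc (s₂ q) (s₂ r) ⟩
    1 + (s₂ q + s₂ r)           ≡⟨ cong suc (s₂-complement a {q} {r} (*-cancelˡ-≡ (q + r) (ones a) 2 halves)) ⟩
    suc a                       ∎
    where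
    open ≡-Reasoning
    halves : 2 * (q + r) ≡ 2 * ones a
    halves = suc-injective (trans (regroup q r) eq)
      where
      regroup : ∀ q r → suc (2 * (q + r)) ≡ 2 * q + (1 + 2 * r)
      regroup = solve-∀
  digits (odd q)  (even r) eq = begin
    s₂ (1 + 2 * q) + s₂ (2 * r) ≡⟨ cong₂ _+_ (s₂-double+1 q) (s₂-double r) ⟩
    1 + (s₂ q + s₂ r)           ≡⟨ cong suc (s₂-complement a {q} {r} (*-cancelˡ-≡ (q + r) (ones a) 2 halves)) ⟩
    suc a                       ∎
    where
    open ≡-Reasoning
    halves : 2 * (q + r) ≡ 2 * ones a
    halves = trans (*-distribˡ-+ 2 q r) (suc-injective eq)

s₂-ones : ∀ a → s₂ (ones a) ≡ a
s₂-ones a = trans (sym (+-identityʳ _)) (s₂-complement a {ones a} {0} (+-identityʳ (ones a)))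

fromBits : List ℕ → ℕ
fromBits []       = 0
fromBits (d ∷ ds) = d + 2 * fromBits ds

take-bits : ∀ ds k → take (length ds) (bits k) ≡ ds → ∃[ C ] k ≡ 2 ^ length ds * C + fromBits ds
take-bits []       k _ = k , sym (trans (+-identityʳ _) (+-identityʳ k))
take-bits (d ∷ ds) (suc m) eq
  with d≡ , rest ← ∷-injective (trans (cong (take (suc (length ds))) (sym (bits-suc m))) eq)
  with C , m/2≡ ← take-bits ds (suc m / 2) rest
  = C , (begin
    suc m                                        ≡⟨ m≡m%n+[m/n]*n (suc m) 2 ⟩
    suc m % 2 + suc m / 2 * 2                    ≡⟨ cong₂ (λ b h → b + h * 2) d≡ m/2≡ ⟩
    d + (2 ^ length ds * C + fromBits ds) * 2    ≡⟨ regroup (2 ^ length ds) C d (fromBits ds) ⟩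
    2 * 2 ^ length ds * C + (d + 2 * fromBits ds) ∎)
  where
  open ≡-Reasoning
  regroup : ∀ P C d v → d + (P * C + v) * 2 ≡ 2 * P * C + (d + 2 * v)
  regroup = solve-∀

fromBits-ones++ : ∀ u ds → fromBits (replicate u 1 ++ ds) ≡ ones u + 2 ^ u * fromBits ds
fromBits-ones++ zero    ds = sym (+-identityʳ _)
fromBits-ones++ (suc u) ds = trans (cong (λ v → 1 + 2 * v) (fromBits-ones++ u ds))
                                   (distrib (ones u) (2 ^ u) (fromBits ds))
  where
  distrib : ∀ o P v → 1 + 2 * (o + P * v) ≡ 1 + 2 * o + 2 * P * v
  distrib = solve-∀

length-ones++ : ∀ u ds → length (replicate u 1 ++ ds) ≡ u + length ds
length-ones++ zero    ds = refl
length-ones++ (suc u) ds = cong suc (length-ones++ u ds)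

reverse-replicate : ∀ u (x : ℕ) → reverse (replicate u x) ≡ replicate u x
reverse-replicate zero    x = refl
reverse-replicate (suc u) x = begin
  reverse (x ∷ replicate u x) ≡⟨ unfold-reverse x (replicate u x) ⟩
  reverse (replicate u x) ∷ʳ x ≡⟨ cong (_∷ʳ x) (reverse-replicate u x) ⟩
  replicate u x ∷ʳ x           ≡⟨ replicate-∷ʳ u ⟩
  x ∷ replicate u x            ∎
  where
  open ≡-Reasoning
  replicate-∷ʳ : ∀ u → replicate u x ∷ʳ x ≡ x ∷ replicate u x
  replicate-∷ʳ zero    = refl
  replicate-∷ʳ (suc u) = cong (x ∷_) (replicate-∷ʳ u)

-- The binary expansion of ending101 u C is that of C followed by 1 0 1^u.
ending101 : ℕ → ℕ → ℕ
ending101 u C = 2 ^ (2 + u) * C + (ones u + 2 ^ u * 2)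

low-digits : ∀ u k → L (u + 2) k ≡ 1 ∷ 0 ∷ replicate u 1 → ∃[ C ] k ≡ ending101 u C
low-digits u k L≡ =
  let C , k≡ = take-bits ds k take≡ in
  C , trans k≡ (cong₂ (λ a v → 2 ^ a * C + v) (trans (length-ones++ u _) (+-comm u 2)) (fromBits-ones++ u _))
  where
  ds : List ℕ
  ds = replicate u 1 ++ 0 ∷ 1 ∷ []
  take≡ : take (length ds) (bits k) ≡ ds
  take≡ = begin
    take (length ds) (bits k)                     ≡⟨ cong (λ n → take n (bits k)) (length-ones++ u _) ⟩
    take (u + 2) (bits k)                         ≡⟨ reverse-involutive _ ⟨
    reverse (L (u + 2) k)                         ≡⟨ cong reverse L≡ ⟩
    reverse ((1 ∷ 0 ∷ []) ++ replicate u 1)       ≡⟨ reverse-++ (1 ∷ 0 ∷ []) (replicate u 1) ⟩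
    reverse (replicate u 1) ++ 0 ∷ 1 ∷ []         ≡⟨ cong (_++ 0 ∷ 1 ∷ []) (reverse-replicate u 1) ⟩
    ds                                            ∎
    where open ≡-Reasoning

SmallMultipleOfWeight : ℕ → ℕ → Set
SmallMultipleOfWeight k s = ∃[ n ] n < k × s₂ (k * n) ≡ s

<-by-gap : ∀ {a b} c → b ≡ suc (a + c) → a < b
<-by-gap {a} c refl = s≤s (m≤m+n a c)

*+<* : ∀ M {x m y} → x < m → y < M → M * x + y < M * m
*+<* M {x} {m} {y} x<m y<M = begin-strict
  M * x + y      <⟨ +-monoʳ-< (M * x) y<M ⟩
  M * x + M      ≡⟨ trans (+-comm (M * x) M) (sym (*-suc M x)) ⟩
  M * suc x      ≤⟨ *-monoʳ-≤ M x<m ⟩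
  M * m          ∎
  where open ≤-Reasoning

4*+<4*suc : ∀ {x m r} → x ≤ m → r < 4 → 4 * x + r < 4 * suc m
4*+<4*suc x≤m r<4 = *+<* 4 (s≤s x≤m) r<4

s₂-concat′ : ∀ a {T} x {y} → T ≡ 2 ^ a → y < T → s₂ (T * x + y) ≡ s₂ x + s₂ y
s₂-concat′ a x refl = s₂-concat a x

s₂-blocks : ∀ a {T} A {R B} → T ≡ 2 ^ a → R < T → B < T → s₂ (T * (T * A + R) + B) ≡ s₂ A + s₂ R + s₂ B
s₂-blocks a {T} A {R} T≡ R<T B<T =
  trans (s₂-concat′ a (T * A + R) T≡ B<T) (cong (_+ _) (s₂-concat′ a A T≡ R<T))

1<4 : 1 < 4
1<4 = s≤s (s≤s z≤n)

2<4 : 2 < 4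
2<4 = s≤s (s≤s (s≤s z≤n))

3<4 : 3 < 4
3<4 = n<1+n 3

s₂-4*+ : ∀ x {r} → r < 4 → s₂ (4 * x + r) ≡ s₂ x + s₂ r
s₂-4*+ x = s₂-concat 2 x

module _ (w : ℕ) where
  private
    o Q : ℕ
    o = ones w
    Q = 4 * suc o

    Q≡2^ : Q ≡ 2 ^ (2 + w)
    Q≡2^ = trans (quadruple (suc o)) (cong (λ P → 2 * (2 * P)) (sym (2^≡1+ones w)))
      where
      quadruple : ∀ P → 4 * P ≡ 2 * (2 * P)
      quadruple = solve-∀

    Q*4P≡2^ : ∀ d {P} → 2 ^ d ≡ P → Q * (4 * P) ≡ 2 ^ (2 + w + (2 + d))
    Q*4P≡2^ d {P} 2^d≡P =
      trans (cong₂ _*_ Q≡2^ (trans (quadruple P) (cong (λ P → 2 * (2 * P)) (sym 2^d≡P))))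
            (sym (^-distribˡ-+-* 2 (2 + w) (2 + d)))
      where
      quadruple : ∀ P → 4 * P ≡ 2 * (2 * P)
      quadruple = solve-∀

    1<Q : 1 < Q
    1<Q = 4*+<4*suc z≤n 1<4

    4o+1<Q : 4 * o + 1 < Q
    4o+1<Q = 4*+<4*suc ≤-refl 1<4

    4o+3<Q : 4 * o + 3 < Q
    4o+3<Q = 4*+<4*suc ≤-refl 3<4

    s₂-Q*+ : ∀ x {y} → y < Q → s₂ (Q * x + y) ≡ s₂ x + s₂ y
    s₂-Q*+ x = s₂-concat′ (2 + w) x Q≡2^

    s₂-4o+1 : s₂ (4 * o + 1) ≡ w + 1
    s₂-4o+1 = trans (s₂-4*+ o 1<4) (cong (_+ 1) (s₂-ones w))

    s₂-4o+3 : s₂ (4 * o + 3) ≡ w + 2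
    s₂-4o+3 = trans (s₂-4*+ o 3<4) (cong (_+ 2) (s₂-ones w))

    ending101≡ : ∀ C → ending101 (2 + w) C ≡ 16 * suc o * C + 8 * suc o + 4 * o + 3
    ending101≡ C = trans (cong (λ P → 2 * (2 * (2 * (2 * P))) * C + (1 + 2 * (1 + 2 * o) + 2 * (2 * P) * 2))
                               (2^≡1+ones w))
                         (expand o C)
      where
      expand : ∀ o C → 2 * (2 * (2 * (2 * suc o))) * C + (1 + 2 * (1 + 2 * o) + 2 * (2 * suc o) * 2)
                       ≡ 16 * suc o * C + 8 * suc o + 4 * o + 3
      expand = solve-∀

    ending101-multiple : ∀ {C s} n → n < 16 * suc o * C + 8 * suc o + 4 * o + 3 →
               s₂ ((16 * suc o * C + 8 * suc o + 4 * o + 3) * n) ≡ s →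
               SmallMultipleOfWeight (ending101 (2 + w) C) s
    ending101-multiple {C} {s} n n<k weight = subst (λ k → SmallMultipleOfWeight k s) (sym (ending101≡ C)) (n , n<k , weight)

  weight-all-ones-short : ∀ {c} → c ≤ w → SmallMultipleOfWeight (ending101 (2 + w) (ones c)) (c + c + w + 5)
  weight-all-ones-short {c} c≤w = ending101-multiple n n<k weight
    where
    open ≡-Reasoning
    γ n k : ℕ
    γ = ones c
    n = Q + 1
    k = 16 * suc o * γ + 8 * suc o + 4 * o + 3

    n<k : n < k
    n<k = <-by-gap (16 * suc o * γ + 4 * suc o + 4 * o + 1) (gap o γ)
      where
      gap : ∀ o γ → 16 * suc o * γ + 8 * suc o + 4 * o + 3
                    ≡ suc (4 * suc o + 1 + (16 * suc o * γ + 4 * suc o + 4 * o + 1))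
      gap = solve-∀

    weight : s₂ (k * n) ≡ c + c + w + 5
    weight = begin
      s₂ (k * n)                                             ≡⟨ cong s₂ (blocks o γ) ⟩
      s₂ (Q * (Q * (4 * γ + 3) + (4 * γ + 1)) + (4 * o + 3)) ≡⟨ s₂-blocks (2 + w) (4 * γ + 3) Q≡2^
                                                                  (4*+<4*suc (ones-mono-≤ c≤w) 1<4) 4o+3<Q ⟩
      s₂ (4 * γ + 3) + s₂ (4 * γ + 1) + s₂ (4 * o + 3)       ≡⟨ cong₂ _+_ (cong₂ _+_ (s₂-4*+ γ 3<4) (s₂-4*+ γ 1<4)) s₂-4o+3 ⟩
      s₂ γ + 2 + (s₂ γ + 1) + (w + 2)                        ≡⟨ cong (λ s → s + 2 + (s + 1) + (w + 2)) (s₂-ones c) ⟩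
      c + 2 + (c + 1) + (w + 2)                              ≡⟨ collect c w ⟩
      c + c + w + 5                                          ∎
      where
      blocks : ∀ o γ → (16 * suc o * γ + 8 * suc o + 4 * o + 3) * (4 * suc o + 1)
                       ≡ 4 * suc o * (4 * suc o * (4 * γ + 3) + (4 * γ + 1)) + (4 * o + 3)
      blocks = solve-∀
      collect : ∀ c w → c + 2 + (c + 1) + (w + 2) ≡ c + c + w + 5
      collect = solve-∀

  weight-leading-1 : ∀ d {C} → C < 2 ^ d → SmallMultipleOfWeight (ending101 (2 + w) (2 ^ d + C)) (w + d + 5)
  weight-leading-1 d {C} C<2^d with y , C+y≡ ← complement d C<2^d =
    subst (λ P → SmallMultipleOfWeight (ending101 (2 + w) (P + C)) (w + d + 5)) (sym 2^d≡P)
          (ending101-multiple n n<k weight)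
    where
    open ≡-Reasoning
    P T n k R Y : ℕ
    P = suc (C + y)
    T = Q * (4 * P)
    n = 16 * suc o * (C + y) + 16 * o + 15
    k = 16 * suc o * (P + C) + 8 * suc o + 4 * o + 3
    R = Q * (4 * C + 2) + (4 * o + 1)
    Y = Q * (4 * y + 1) + 1

    2^d≡P : 2 ^ d ≡ P
    2^d≡P = trans (2^≡1+ones d) (cong suc (sym C+y≡))

    n<k : n < k
    n<k = <-by-gap (16 * suc o * C + 8 * suc o + 4 * o + 3) (gap o C y)
      where
      gap : ∀ o C y → 16 * suc o * (suc (C + y) + C) + 8 * suc o + 4 * o + 3
                      ≡ suc (16 * suc o * (C + y) + 16 * o + 15 + (16 * suc o * C + 8 * suc o + 4 * o + 3))
      gap = solve-∀

    R<T : R < T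
    R<T = *+<* Q (4*+<4*suc (m≤m+n C y) 2<4) 4o+1<Q
    Y<T : Y < T
    Y<T = *+<* Q (4*+<4*suc (m≤n+m y C) 1<4) 1<Q

    weight : s₂ (k * n) ≡ w + d + 5
    weight = begin
      s₂ (k * n)                                 ≡⟨ cong s₂ (blocks o C y) ⟩
      s₂ (T * (T * 1 + R) + Y)                   ≡⟨ s₂-blocks (2 + w + (2 + d)) 1 (Q*4P≡2^ d 2^d≡P) R<T Y<T ⟩
      1 + s₂ R + s₂ Y                            ≡⟨ cong₂ (λ r y → 1 + r + y) s₂R s₂Y ⟩
      1 + (s₂ C + 1 + (w + 1)) + (s₂ y + 1 + 1)  ≡⟨ collect (s₂ C) (s₂ y) w ⟩
      w + (s₂ C + s₂ y) + 5                      ≡⟨ cong (λ s → w + s + 5) (s₂-complement d {C} {y} C+y≡) ⟩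
      w + d + 5                                  ∎
      where
      blocks : ∀ o C y → (16 * suc o * (suc (C + y) + C) + 8 * suc o + 4 * o + 3) * (16 * suc o * (C + y) + 16 * o + 15)
                         ≡ 4 * suc o * (4 * suc (C + y)) * (4 * suc o * (4 * suc (C + y)) * 1
                             + (4 * suc o * (4 * C + 2) + (4 * o + 1)))
                           + (4 * suc o * (4 * y + 1) + 1)
      blocks = solve-∀
      s₂R : s₂ R ≡ s₂ C + 1 + (w + 1)
      s₂R = trans (s₂-Q*+ (4 * C + 2) 4o+1<Q) (cong₂ _+_ (s₂-4*+ C 2<4) s₂-4o+1)
      s₂Y : s₂ Y ≡ s₂ y + 1 + 1
      s₂Y = trans (s₂-Q*+ (4 * y + 1) 1<Q) (cong (_+ 1) (s₂-4*+ y 1<4))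
      collect : ∀ a b w → 1 + (a + 1 + (w + 1)) + (b + 1 + 1) ≡ w + (a + b) + 5
      collect = solve-∀

  weight-leading-ones : ∀ d {C} → C < 2 ^ d →
                        SmallMultipleOfWeight (ending101 (2 + w) (2 ^ d * ones (2 + w) + C)) (w + w + d + 7)
  weight-leading-ones d {C} C<2^d with z , C+z≡ ← complement d C<2^d =
    subst (λ P → SmallMultipleOfWeight (ending101 (2 + w) (P * ones (2 + w) + C)) (w + w + d + 7)) (sym 2^d≡P)
          (ending101-multiple n n<k weight)
    where
    open ≡-Reasoning
    P T n k R Y : ℕ
    P = suc (C + z)
    T = Q * (4 * P)
    n = 16 * suc o * (C + z) + 16 * o + 15
    k = 16 * suc o * (P * ones (2 + w) + C) + 8 * suc o + 4 * o + 3
    R = Q * (4 * C + 1) + (4 * o + 3)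
    Y = Q * (4 * z + 1) + 1

    2^d≡P : 2 ^ d ≡ P
    2^d≡P = trans (2^≡1+ones d) (cong suc (sym C+z≡))

    n<k : n < k
    n<k = <-by-gap (16 * suc o * P * (4 * o + 2) + 16 * suc o * C + 8 * suc o + 4 * o + 3) (gap o C z)
      where
      gap : ∀ o C z → 16 * suc o * (suc (C + z) * (1 + 2 * (1 + 2 * o)) + C) + 8 * suc o + 4 * o + 3
                      ≡ suc (16 * suc o * (C + z) + 16 * o + 15
                             + (16 * suc o * suc (C + z) * (4 * o + 2) + 16 * suc o * C + 8 * suc o + 4 * o + 3))
      gap = solve-∀

    R<T : R < T
    R<T = *+<* Q (4*+<4*suc (m≤m+n C z) 1<4) 4o+3<Q
    Y<T : Y < T
    Y<T = *+<* Q (4*+<4*suc (m≤n+m z C) 1<4) 1<Q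

    weight : s₂ (k * n) ≡ w + w + d + 7
    weight = begin
      s₂ (k * n)                                     ≡⟨ cong s₂ (blocks o C z) ⟩
      s₂ (T * (T * (4 * o + 3) + R) + Y)             ≡⟨ s₂-blocks (2 + w + (2 + d)) (4 * o + 3) (Q*4P≡2^ d 2^d≡P) R<T Y<T ⟩
      s₂ (4 * o + 3) + s₂ R + s₂ Y                   ≡⟨ cong₂ _+_ (cong₂ _+_ s₂-4o+3 s₂R) s₂Y ⟩
      w + 2 + (s₂ C + 1 + (w + 2)) + (s₂ z + 1 + 1)  ≡⟨ collect (s₂ C) (s₂ z) w ⟩
      w + w + (s₂ C + s₂ z) + 7                      ≡⟨ cong (λ s → w + w + s + 7) (s₂-complement d {C} {z} C+z≡) ⟩
      w + w + d + 7                                  ∎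
      where
      blocks : ∀ o C z → (16 * suc o * (suc (C + z) * (1 + 2 * (1 + 2 * o)) + C) + 8 * suc o + 4 * o + 3)
                           * (16 * suc o * (C + z) + 16 * o + 15)
                         ≡ 4 * suc o * (4 * suc (C + z)) * (4 * suc o * (4 * suc (C + z)) * (4 * o + 3)
                             + (4 * suc o * (4 * C + 1) + (4 * o + 3)))
                           + (4 * suc o * (4 * z + 1) + 1)
      blocks = solve-∀
      s₂R : s₂ R ≡ s₂ C + 1 + (w + 2)
      s₂R = trans (s₂-Q*+ (4 * C + 1) 4o+3<Q) (cong₂ _+_ (s₂-4*+ C 1<4) s₂-4o+3)
      s₂Y : s₂ Y ≡ s₂ z + 1 + 1
      s₂Y = trans (s₂-Q*+ (4 * z + 1) 1<Q) (cong (_+ 1) (s₂-4*+ z 1<4))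
      collect : ∀ a b w → w + 2 + (a + 1 + (w + 2)) + (b + 1 + 1) ≡ w + w + (a + b) + 7
      collect = solve-∀

  weight-short-run : ∀ g r {C} → r ≤ w → C < 2 ^ g →
                     SmallMultipleOfWeight (ending101 (2 + w) (2 ^ g * (2 * ones (suc r)) + C))
                                           (r + r + s₂ C + s₂ C + w + 7)
  weight-short-run g r {C} r≤w C<2^g with y , C+y≡ ← complement g C<2^g =
    subst (λ P → SmallMultipleOfWeight (ending101 (2 + w) (P * (2 * ones (suc r)) + C)) (r + r + s₂ C + s₂ C + w + 7))
          (sym 2^g≡P) (ending101-multiple n n<k weight)
    where
    open ≡-Reasoning
    α P T n k R B : ℕ
    α = ones r
    P = suc (C + y)
    T = Q * (4 * P)
    n = 16 * suc o * P + 1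
    k = 16 * suc o * (P * (2 * (1 + 2 * α)) + C) + 8 * suc o + 4 * o + 3
    R = Q * (4 * C + 3) + (4 * α + 1)
    B = Q * (4 * C + 2) + (4 * o + 3)

    2^g≡P : 2 ^ g ≡ P
    2^g≡P = trans (2^≡1+ones g) (cong suc (sym C+y≡))

    n<k : n < k
    n<k = <-by-gap (16 * suc o * P * (4 * α + 1) + 16 * suc o * C + 8 * suc o + 4 * o + 1) (gap o α P C)
      where
      gap : ∀ o α P C → 16 * suc o * (P * (2 * (1 + 2 * α)) + C) + 8 * suc o + 4 * o + 3
                        ≡ suc (16 * suc o * P + 1 + (16 * suc o * P * (4 * α + 1) + 16 * suc o * C + 8 * suc o + 4 * o + 1))
      gap = solve-∀

    4α+1<Q : 4 * α + 1 < Q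
    4α+1<Q = 4*+<4*suc (ones-mono-≤ r≤w) 1<4
    R<T : R < T
    R<T = *+<* Q (4*+<4*suc (m≤m+n C y) 3<4) 4α+1<Q
    B<T : B < T
    B<T = *+<* Q (4*+<4*suc (m≤m+n C y) 2<4) 4o+3<Q

    weight : s₂ (k * n) ≡ r + r + s₂ C + s₂ C + w + 7
    weight = begin
      s₂ (k * n)                                           ≡⟨ cong s₂ (blocks o α P C) ⟩
      s₂ (T * (T * (4 * α + 2) + R) + B)                   ≡⟨ s₂-blocks (2 + w + (2 + g)) (4 * α + 2) (Q*4P≡2^ g 2^g≡P) R<T B<T ⟩
      s₂ (4 * α + 2) + s₂ R + s₂ B                         ≡⟨ cong₂ _+_ (cong₂ _+_ s₂A s₂R) s₂B ⟩
      r + 1 + (s₂ C + 2 + (r + 1)) + (s₂ C + 1 + (w + 2))  ≡⟨ collect r (s₂ C) w ⟩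
      r + r + s₂ C + s₂ C + w + 7                          ∎
      where
      blocks : ∀ o α P C → (16 * suc o * (P * (2 * (1 + 2 * α)) + C) + 8 * suc o + 4 * o + 3) * (16 * suc o * P + 1)
                           ≡ 4 * suc o * (4 * P) * (4 * suc o * (4 * P) * (4 * α + 2)
                               + (4 * suc o * (4 * C + 3) + (4 * α + 1)))
                             + (4 * suc o * (4 * C + 2) + (4 * o + 3))
      blocks = solve-∀
      s₂A : s₂ (4 * α + 2) ≡ r + 1
      s₂A = trans (s₂-4*+ α 2<4) (cong (_+ 1) (s₂-ones r))
      s₂R : s₂ R ≡ s₂ C + 2 + (r + 1)
      s₂R = trans (s₂-Q*+ (4 * C + 3) 4α+1<Q)
                  (cong₂ _+_ (s₂-4*+ C 3<4) (trans (s₂-4*+ α 1<4) (cong (_+ 1) (s₂-ones r))))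
      s₂B : s₂ B ≡ s₂ C + 1 + (w + 2)
      s₂B = trans (s₂-Q*+ (4 * C + 2) 4o+3<Q) (cong₂ _+_ (s₂-4*+ C 2<4) s₂-4o+3)
      collect : ∀ r c w → r + 1 + (c + 2 + (r + 1)) + (c + 1 + (w + 2)) ≡ r + r + c + c + w + 7
      collect = solve-∀

data LeadingRun : ℕ → Set where
  all-ones   : ∀ c → LeadingRun (ones c)
  run-above-0 : ∀ g r {C} → C < 2 ^ g → LeadingRun (2 ^ g * (2 * ones (suc r)) + C)

leading-run-below : ∀ n {C} → C < 2 ^ n → LeadingRun C
leading-run-below zero    (s≤s z≤n) = all-ones 0
leading-run-below (suc n) {C} C<2^1+n = go (even-or-odd C) C<2^1+n
  where
  go : ∀ {C} → EvenOdd C → C < 2 ^ suc n → LeadingRun C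
  go (even q) 2q< with leading-run-below n (*-cancelˡ-< 2 q (2 ^ n) 2q<)
  ... | all-ones zero    = all-ones 0
  ... | all-ones (suc c) = subst LeadingRun (trans (+-identityʳ _) (*-identityˡ _)) (run-above-0 0 c (s≤s z≤n))
  ... | run-above-0 g r {C} C<2^g =
    subst LeadingRun (shift (2 ^ g) (ones (suc r)) C) (run-above-0 (suc g) r (*-monoʳ-< 2 C<2^g))
    where
    shift : ∀ G X C → 2 * G * (2 * X) + 2 * C ≡ 2 * (G * (2 * X) + C)
    shift = solve-∀
  go (odd q) 1+2q< with leading-run-below n (*-cancelˡ-< 2 q (2 ^ n) (<-trans (n<1+n _) 1+2q<))
  ... | all-ones c = all-ones (suc c)
  ... | run-above-0 g r {C} C<2^g =
    subst LeadingRun (shift (2 ^ g) (ones (suc r)) C) (run-above-0 (suc g) r 1+2C<2*2^g)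
    where
    1+2C<2*2^g : 1 + 2 * C < 2 * 2 ^ g
    1+2C<2*2^g = subst (_< 2 * 2 ^ g) (+-comm (2 * C) 1) (*+<* 2 C<2^g (s≤s (s≤s z≤n)))
    shift : ∀ G X C → 2 * G * (2 * X) + (1 + 2 * C) ≡ 1 + 2 * (G * (2 * X) + C)
    shift = solve-∀

n≤ones : ∀ n → n ≤ ones n
n≤ones zero    = z≤n
n≤ones (suc n) = s≤s (≤-trans (n≤ones n) (m≤m+n (ones n) _))

leading-run : ∀ C → LeadingRun C
leading-run C = leading-run-below C (≤-<-trans (n≤ones C) (ones<2^ C))

run-split : ∀ g h X C → 2 ^ g * (2 * (2 ^ h * X + ones h)) + C ≡ 2 ^ (suc g + h) * X + (2 ^ suc g * ones h + C)
run-split g h X C = trans (regroup (2 ^ g) (2 ^ h) X (ones h) C)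
                          (cong (λ P → P * X + (2 ^ suc g * ones h + C)) (sym (^-distribˡ-+-* 2 (suc g) h)))
  where
  regroup : ∀ G H X o C → G * (2 * (H * X + o)) + C ≡ 2 * G * H * X + (2 * G * o + C)
  regroup = solve-∀

run-split-< : ∀ g h {C} → C < 2 ^ g → 2 ^ suc g * ones h + C < 2 ^ (suc g + h)
run-split-< g h {C} C<2^g = subst (2 ^ suc g * ones h + C <_) (sym (^-distribˡ-+-* 2 (suc g) h))
  (*+<* (2 ^ suc g) (ones<2^ h) (<-≤-trans C<2^g (^-monoʳ-≤ 2 (n≤1+n g))))

OddMultipleBelow : ℕ → Set
OddMultipleBelow k = ∃[ n ] n < k × t (k * n) ≡ 1

odd-multiple-from : ∀ {k k′ s} m → k ≡ k′ → s ≡ 1 + 2 * m → SmallMultipleOfWeight k′ s → OddMultipleBelow k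
odd-multiple-from m refl refl (n , n<k , weight) = n , n<k , trans (cong (_% 2) weight) ([1+2*n]%2≡1 m)

module _ (w' : ℕ) where
  private
    w : ℕ
    w = 2 * w'

  odd-multiple-all-ones : ∀ {c} → EvenOdd c → OddMultipleBelow (ending101 (2 + w) (ones c))
  odd-multiple-all-ones (odd q) =
    odd-multiple-from (w' + q + 2) (cong (ending101 (2 + w)) ones≡) (parity w' q)
      (weight-leading-1 w (2 * q) (ones<2^ (2 * q)))
    where
    ones≡ : ones (1 + 2 * q) ≡ 2 ^ (2 * q) + ones (2 * q)
    ones≡ = trans (ones-+ 1 (2 * q)) (cong (_+ ones (2 * q)) (*-identityʳ _))
    parity : ∀ w' q → 2 * w' + 2 * q + 5 ≡ 1 + 2 * (w' + q + 2)
    parity = solve-∀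
  odd-multiple-all-ones (even q) with q ≤? w'
  ... | yes q≤w' = odd-multiple-from (q + q + w' + 2) refl (parity w' q)
                     (weight-all-ones-short w (*-monoʳ-≤ 2 q≤w'))
    where
    parity : ∀ w' q → 2 * q + 2 * q + 2 * w' + 5 ≡ 1 + 2 * (q + q + w' + 2)
    parity = solve-∀
  ... | no q≰w' with e , w'+e≡ ← m≤n⇒∃[o]m+o≡n (≰⇒> q≰w') =
    odd-multiple-from (w + e + 3) (cong (ending101 (2 + w)) ones≡) (parity w' e)
      (weight-leading-ones w (2 * e) (ones<2^ (2 * e)))
    where
    ones≡ : ones (2 * q) ≡ 2 ^ (2 * e) * ones (2 + w) + ones (2 * e)
    ones≡ = trans (cong (λ q → ones (2 * q)) (sym w'+e≡)) (trans (cong ones (double w' e)) (ones-+ (2 + w) (2 * e)))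
      where
      double : ∀ w' e → 2 * (suc w' + e) ≡ 2 + 2 * w' + 2 * e
      double = solve-∀
    parity : ∀ w' e → 2 * w' + 2 * w' + 2 * e + 7 ≡ 1 + 2 * (2 * w' + e + 3)
    parity = solve-∀

  -- p is the position of the top bit.  For p even split off 2^p; for p odd split off the top
  -- block 1^(w+2), which then starts at the even position p − w − 1.
  odd-multiple-long-run : ∀ g h {C} → C < 2 ^ g → ∀ {p} → EvenOdd p → p ≡ g + suc (suc w + h) →
                          OddMultipleBelow (ending101 (2 + w) (2 ^ g * (2 * ones (suc (suc w + h))) + C))
  odd-multiple-long-run g h {C} C<2^g (even q) top≡ =
    odd-multiple-from (w' + q + 2) (cong (ending101 (2 + w)) C≡) parity
      (weight-leading-1 w (suc g + r) (run-split-< g r C<2^g))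
    where
    r : ℕ
    r = suc w + h
    C≡ : 2 ^ g * (2 * ones (suc r)) + C ≡ 2 ^ (suc g + r) + (2 ^ suc g * ones r + C)
    C≡ = trans (cong (λ X → 2 ^ g * (2 * X) + C) (ones-+ 1 r))
               (trans (run-split g r 1 C) (cong (_+ (2 ^ suc g * ones r + C)) (*-identityʳ (2 ^ (suc g + r)))))
    parity : w + (suc g + r) + 5 ≡ 1 + 2 * (w' + q + 2)
    parity = trans (cong (λ p → w + p + 5) (trans (sym (+-suc g r)) (sym top≡))) (collect w' q)
      where
      collect : ∀ w' q → 2 * w' + 2 * q + 5 ≡ 1 + 2 * (w' + q + 2)
      collect = solve-∀
  odd-multiple-long-run g h {C} C<2^g (odd q) top≡ =
    odd-multiple-from (w' + q + 3) (cong (ending101 (2 + w)) C≡) parity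
      (weight-leading-ones w (suc g + h) (run-split-< g h C<2^g))
    where
    C≡ : 2 ^ g * (2 * ones (suc (suc w + h))) + C ≡ 2 ^ (suc g + h) * ones (2 + w) + (2 ^ suc g * ones h + C)
    C≡ = trans (cong (λ n → 2 ^ g * (2 * ones n) + C) (sym (+-assoc 2 w h)))
               (trans (cong (λ X → 2 ^ g * (2 * X) + C) (ones-+ (2 + w) h)) (run-split g h (ones (2 + w)) C))
    parity : w + w + (suc g + h) + 7 ≡ 1 + 2 * (w' + q + 3)
    parity = trans (regroup w g h) (trans (cong (λ p → w + p + 6) (sym top≡)) (collect w' q))
      where
      regroup : ∀ w g h → w + w + (suc g + h) + 7 ≡ w + (g + suc (suc w + h)) + 6
      regroup = solve-∀
      collect : ∀ w' q → 2 * w' + (1 + 2 * q) + 6 ≡ 1 + 2 * (w' + q + 3)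
      collect = solve-∀

  odd-multiple : ∀ {C} → LeadingRun C → OddMultipleBelow (ending101 (2 + w) C)
  odd-multiple (all-ones c) = odd-multiple-all-ones (even-or-odd c)
  odd-multiple (run-above-0 g r {C} C<2^g) with r ≤? w
  ... | yes r≤w = odd-multiple-from (r + s₂ C + w' + 3) refl (parity r (s₂ C) w')
                    (weight-short-run w g r r≤w C<2^g)
    where
    parity : ∀ r c w' → r + r + c + c + 2 * w' + 7 ≡ 1 + 2 * (r + c + w' + 3)
    parity = solve-∀
  ... | no r≰w with h , refl ← m≤n⇒∃[o]m+o≡n (≰⇒> r≰w) =
    odd-multiple-long-run g h C<2^g (even-or-odd _) refl

LeastWitnessUpTo : (ℕ → Set) → ℕ → Set
LeastWitnessUpTo P n = ∃[ m ] m ≤ n × P m × (∀ {i} → i < m → ¬ P i)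

least-witness : ∀ {P : ℕ → Set} → Decidable P → ∀ n → P n → LeastWitnessUpTo P n
least-witness {P} P? = <-rec (λ n → P n → LeastWitnessUpTo P n) search
  where
  search : ∀ n → (∀ {i} → i < n → P i → LeastWitnessUpTo P i) → P n → LeastWitnessUpTo P n
  search n below Pn with anyUpTo? P? n
  ... | no none = n , ≤-refl , Pn , λ i<n Pi → none (_ , i<n , Pi)
  ... | yes (i , i<n , Pi) =
    let m , m≤i , Pm , least = below i<n Pi in m , ≤-trans m≤i (<⇒≤ i<n) , Pm , least

t≢1⇒t≡0 : ∀ x → ¬ t x ≡ 1 → t x ≡ 0
t≢1⇒t≡0 x t≢1 with t x | m%n<n (s₂ x) 2
... | zero        | _ = refl
... | suc zero    | _ = contradiction refl t≢1
... | suc (suc _) | s≤s (s≤s ())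

f<k : ∀ {k} → OddMultipleBelow k → ∃[ m ] IsF k m × m < k
f<k {k} (n , n<k , t≡1) with m , m≤n , t≡1 , below ← least-witness (λ i → t (k * i) ≟ 1) n t≡1 =
  m , (t≡1 , λ i i<m → t≢1⇒t≡0 (k * i) (below i<m)) , ≤-<-trans m≤n n<k

lemma2 : (k : ℕ) → 1 ≤ k →
    (∃[ u ] ((∃[ v ] u ≡ 2 * v) × 2 ≤ u × u + 2 ≤ ℓ k ×
      L (u + 2) k ≡ 1 ∷ 0 ∷ replicate u 1)) →
    ∃[ m ] (IsF k m × m < k)
-- The hypotheses 1 ≤ k and u + 2 ≤ ℓ k are implied by the shape of L (u + 2) k.
lemma2 k _ (_ , (zero , refl) , () , _)
lemma2 k _ (_ , (suc w' , refl) , _ , _ , L≡)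
  with C , k≡ ← low-digits (2 + 2 * w') k (subst (λ u → L (u + 2) k ≡ 1 ∷ 0 ∷ replicate u 1) (*-suc 2 w') L≡) =
  f<k (subst OddMultipleBelow (sym k≡) (odd-multiple w' (leading-run C)))
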